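{- Let $f = \sum_{i=0}^n c_i x^{k_i} \in \mathbb{N}_0[x^{\pm 1}]$, where $c_0, \ldots, c_n$ are positive integers and $k_0 > \cdots > k_n$ are integers, and suppose $|\operatorname{supp}(f)| > 1$. Then $f$ is irreducible in $\mathbb{N}_0[x^{\pm 1}]$ if and only if $f$ is monolithic and $\gcd(c_0, \ldots, c_n) = 1$.
   Context: $\mathbb{N}_0[x^{\pm 1}]$ denotes the commutative semiring of Laurent polynomials in $x$ with nonnegative integer coefficients. Its units are exactly the monomials $x^k$, $k \in \mathbb{Z}$. An element is irreducible if it is nonzero, not a unit, and cannot be written as a product of two non-units. The support $\operatorname{supp}(f)$ is the set of exponents appearing in $f$ with nonzero coefficient. A nonzero $f \in \mathbb{N}_0[x^{\pm 1}]$ is called monolithic if whenever $f = gh$ with $g, h \in \mathbb{N}_0[x^{\pm 1}]$, at least one of $g$, $h$ is a monomial $c x^k$ ($c$ a positive integer, $k \in \mathbb{Z}$). -}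

module Defs where

open import Data.Nat as ℕ using (ℕ; zero; suc)
open import Data.Nat.GCD using (gcd)
open import Data.Integer as ℤ using (ℤ; +_; _-_; _⊓_; ∣_∣)
open import Data.Integer.Properties using (_≤?_)
open import Data.List using (List; []; _∷_; replicate; _++_; map; foldr; tabulate)
open import Data.Fin using (Fin)
open import Data.Product using (Σ; ∃; _×_; _,_)
open import Data.Sum using (_⊎_)
open import Relation.Nullary using (¬_; yes; no)
open import Relation.Binary.PropositionalEquality using (_≡_; _≢_)

-- Laurent polynomials with coefficients in ℕ, represented as x^shift · (c₀ + c₁x + c₂x² + …).
-- Equality of Laurent polynomials is the semantic one: equality of all coefficients.
record Laurent : Set where
  constructor laurent
  field
    shift  : ℤ
    coeffs : List ℕ
open Laurent public

nth : List ℕ → ℕ → ℕ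
nth []       _       = 0
nth (a ∷ _)  zero    = a
nth (_ ∷ as) (suc n) = nth as n

coeff : Laurent → ℤ → ℕ
coeff (laurent s cs) z with s ℤ.≤? z
... | yes _ = nth cs ∣ z - s ∣
... | no  _ = 0

infix 4 _≈_
_≈_ : Laurent → Laurent → Set
f ≈ g = ∀ z → coeff f z ≡ coeff g z

addP : List ℕ → List ℕ → List ℕ
addP []       q        = q
addP p        []       = p
addP (a ∷ p)  (b ∷ q)  = (a ℕ.+ b) ∷ addP p q

mulP : List ℕ → List ℕ → List ℕ
mulP []      q = []
mulP (a ∷ p) q = addP (map (a ℕ.*_) q) (0 ∷ mulP p q)

infixl 6 _⊕_
infixl 7 _⊗_

_⊕_ : Laurent → Laurent → Laurent
laurent s p ⊕ laurent t q =
  let m = s ⊓ t in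
  laurent m (addP (replicate ∣ s - m ∣ 0 ++ p) (replicate ∣ t - m ∣ 0 ++ q))

_⊗_ : Laurent → Laurent → Laurent
laurent s p ⊗ laurent t q = laurent (s ℤ.+ t) (mulP p q)

𝟘 𝟙 : Laurent
𝟘 = laurent (+ 0) []
𝟙 = laurent (+ 0) (1 ∷ [])

mono : ℕ → ℤ → Laurent
mono c k = laurent k (c ∷ [])

IsUnit : Laurent → Set
IsUnit u = ∃ λ v → u ⊗ v ≈ 𝟙

Irreducible : Laurent → Set
Irreducible f =
  (¬ f ≈ 𝟘) × (¬ IsUnit f) × (∀ g h → f ≈ g ⊗ h → IsUnit g ⊎ IsUnit h)

IsMonomial : Laurent → Set
IsMonomial g = Σ ℕ λ c → Σ ℤ λ k → (1 ℕ.≤ c) × (g ≈ mono c k)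

Monolithic : Laurent → Set
Monolithic f =
  (¬ f ≈ 𝟘) × (∀ g h → f ≈ g ⊗ h → IsMonomial g ⊎ IsMonomial h)

SuppGt1 : Laurent → Set
SuppGt1 f = Σ ℤ λ a → Σ ℤ λ b → (a ≢ b) × (coeff f a ≢ 0) × (coeff f b ≢ 0)

sumTerms : ∀ {m} → (Fin m → ℕ) → (Fin m → ℤ) → Laurent
sumTerms c k = foldr _⊕_ 𝟘 (tabulate (λ i → mono (c i) (k i)))

gcdAll : ∀ {m} → (Fin m → ℕ) → ℕ
gcdAll c = foldr gcd 0 (tabulate c)

-- Evaluation at x = 1 is multiplicative, so a unit has coefficient sum 1 and is a power x^w.
-- Hence an irreducible f is monolithic, and every common divisor d of its coefficients is 1:
-- otherwise f = d · (f / d), where d is not a unit and f / d, having the same two-point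
-- support as f, is not one either. Conversely, if f = g h with g = c x^w, then c divides every
-- coefficient of f, hence gcd(c₀, …, cₙ) = 1, so c = 1 and g is a unit.
{-# OPTIONS --safe #-}
module Submission where

open import Defs
open import Data.Nat as ℕ using (ℕ; zero; suc; _≤_; NonZero)
import Data.Nat.Properties as ℕP
open import Data.Nat.Divisibility using (_∣_; _∣0; ∣1⇒≡1; 0∣⇒≡0; ∣m∣n⇒∣m+n; ∣-trans; ∣n⇒∣m*n; ∣m⇒∣m*n; ∣-refl)
open import Data.Nat.GCD using (gcd[m,n]∣m; gcd[m,n]∣n; gcd-greatest)
open import Data.Nat.DivMod using (_/_; 0/n≡0; m*[n/m]≡n)
open import Data.Nat.ListAction using (sum)
open import Data.Nat.Solver using (module +-*-Solver)
open import Data.Integer as ℤ using (ℤ; +_; -_; _>_)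
import Data.Integer.Properties as ℤP
open import Data.Integer.Tactic.RingSolver using (solve-∀)
open import Data.List using (List; []; _∷_; replicate; _++_; map)
open import Data.Fin as Fin using (Fin; _<_)
open import Data.Product using (∃; _×_; _,_)
open import Data.Empty using (⊥-elim)
open import Data.Sum as Sum using (_⊎_; inj₁; inj₂)
open import Function.Base using (_∘_)
open import Function.Bundles using (_⇔_; mk⇔; Equivalence)
open import Relation.Nullary using (¬_; yes; no)
open import Relation.Nullary.Negation using (contradiction)
open import Relation.Binary.PropositionalEquality

i+∣j-i∣≡j : ∀ {i j} → i ℤ.≤ j → i ℤ.+ + ℤ.∣ j ℤ.- i ∣ ≡ j
i+∣j-i∣≡j {i} {j} i≤j = trans (cong (ℤ._+_ i) (ℤP.0≤i⇒+∣i∣≡i (ℤP.i≤j⇒0≤j-i i≤j))) (cancel i j)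
  where cancel : ∀ a b → a ℤ.+ (b ℤ.- a) ≡ b
        cancel = solve-∀

below⊎offset : ∀ s z → z ℤ.< s ⊎ ∃ λ j → z ≡ s ℤ.+ + j
below⊎offset s z with s ℤ.≤? z
... | no s≰z = inj₁ (ℤP.≰⇒> s≰z)
... | yes s≤z = inj₂ (ℤ.∣ z ℤ.- s ∣ , sym (i+∣j-i∣≡j s≤z))

coeff-offset : ∀ s p j → coeff (laurent s p) (s ℤ.+ + j) ≡ nth p j
coeff-offset s p j with s ℤ.≤? s ℤ.+ + j
... | yes _ = cong (λ t → nth p ℤ.∣ t ∣) (cancel s (+ j))
  where cancel : ∀ a b → a ℤ.+ b ℤ.- a ≡ b
        cancel = solve-∀
... | no s≰s+j = contradiction (ℤP.i≤i+j s (+ j)) s≰s+j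

coeff-below : ∀ s p {z} → z ℤ.< s → coeff (laurent s p) z ≡ 0
coeff-below s p {z} z<s with s ℤ.≤? z
... | yes s≤z = contradiction s≤z (ℤP.<⇒≱ z<s)
... | no _ = refl

coeff-cong-nth : ∀ s {p q} → (∀ j → nth p j ≡ nth q j) → laurent s p ≈ laurent s q
coeff-cong-nth s p≗q z with s ℤ.≤? z
... | yes _ = p≗q _
... | no _ = refl

nth-addP : ∀ p q j → nth (addP p q) j ≡ nth p j ℕ.+ nth q j
nth-addP []      q       j       = refl
nth-addP (a ∷ p) []      j       = sym (ℕP.+-identityʳ _)
nth-addP (a ∷ p) (b ∷ q) zero    = refl
nth-addP (a ∷ p) (b ∷ q) (suc j) = nth-addP p q j

nth-map : ∀ (g : ℕ → ℕ) → g 0 ≡ 0 → ∀ p j → nth (map g p) j ≡ g (nth p j)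
nth-map g g0≡0 []      j       = sym g0≡0
nth-map g g0≡0 (a ∷ p) zero    = refl
nth-map g g0≡0 (a ∷ p) (suc j) = nth-map g g0≡0 p j

coeff-addP : ∀ s p q z → coeff (laurent s (addP p q)) z ≡ coeff (laurent s p) z ℕ.+ coeff (laurent s q) z
coeff-addP s p q z with s ℤ.≤? z
... | yes _ = nth-addP p q _
... | no _ = refl

coeff-map : ∀ (g : ℕ → ℕ) → g 0 ≡ 0 → ∀ s p z → coeff (laurent s (map g p)) z ≡ g (coeff (laurent s p) z)
coeff-map g g0≡0 s p z with s ℤ.≤? z
... | yes _ = nth-map g g0≡0 p _
... | no _ = sym g0≡0

coeff-shift : ∀ s u p y → coeff (laurent (s ℤ.+ u) p) (y ℤ.+ u) ≡ coeff (laurent s p) y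
coeff-shift s u p y with below⊎offset s y
... | inj₁ y<s = trans (coeff-below _ p (ℤP.+-monoˡ-< u y<s)) (sym (coeff-below s p y<s))
... | inj₂ (j , refl) = begin
  coeff (laurent (s ℤ.+ u) p) (s ℤ.+ + j ℤ.+ u)  ≡⟨ cong (coeff (laurent (s ℤ.+ u) p)) (swap s u (+ j)) ⟩
  coeff (laurent (s ℤ.+ u) p) (s ℤ.+ u ℤ.+ + j)  ≡⟨ coeff-offset (s ℤ.+ u) p j ⟩
  nth p j                                        ≡⟨ coeff-offset s p j ⟨
  coeff (laurent s p) (s ℤ.+ + j)                ∎
  where open ≡-Reasoning
        swap : ∀ a b c → a ℤ.+ c ℤ.+ b ≡ a ℤ.+ b ℤ.+ c
        swap = solve-∀

coeff-pad : ∀ a s p → laurent s (replicate a 0 ++ p) ≈ laurent (s ℤ.+ + a) p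
coeff-pad zero    s p z = cong (λ t → coeff (laurent t p) z) (sym (ℤP.+-identityʳ s))
coeff-pad (suc a) s p z with below⊎offset s z
... | inj₁ z<s = trans (coeff-below s _ z<s)
                       (sym (coeff-below _ p (ℤP.<-≤-trans z<s (ℤP.i≤i+j s (+ suc a)))))
... | inj₂ (zero , refl) = trans (coeff-offset s _ 0)
                                 (sym (coeff-below _ p (ℤP.+-monoʳ-< s (ℤ.+<+ (ℕ.s≤s ℕ.z≤n)))))
... | inj₂ (suc j , refl) = begin
  coeff (laurent s (0 ∷ replicate a 0 ++ p)) (s ℤ.+ + suc j)  ≡⟨ coeff-offset s _ (suc j) ⟩
  nth (replicate a 0 ++ p) j                                  ≡⟨ coeff-offset (s ℤ.+ + 1) _ j ⟨
  coeff (laurent (s ℤ.+ + 1) (replicate a 0 ++ p)) (s ℤ.+ + 1 ℤ.+ + j)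
    ≡⟨ coeff-pad a (s ℤ.+ + 1) p _ ⟩
  coeff (laurent (s ℤ.+ + 1 ℤ.+ + a) p) (s ℤ.+ + 1 ℤ.+ + j)
    ≡⟨ cong₂ (λ t y → coeff (laurent t p) y) (reassoc s a) (reassoc s j) ⟨
  coeff (laurent (s ℤ.+ + suc a) p) (s ℤ.+ + suc j)            ∎
  where open ≡-Reasoning
        reassoc : ∀ s n → s ℤ.+ + suc n ≡ s ℤ.+ + 1 ℤ.+ + n
        reassoc s n = trans (cong (ℤ._+_ s) (ℤP.pos-+ 1 n)) (sym (ℤP.+-assoc s (+ 1) (+ n)))

coeff-padTo : ∀ {m s} p → m ℤ.≤ s → laurent m (replicate ℤ.∣ s ℤ.- m ∣ 0 ++ p) ≈ laurent s p
coeff-padTo {m} {s} p m≤s z =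
  trans (coeff-pad _ m p z) (cong (λ t → coeff (laurent t p) z) (i+∣j-i∣≡j m≤s))

coeff-⊕ : ∀ f g z → coeff (f ⊕ g) z ≡ coeff f z ℕ.+ coeff g z
coeff-⊕ (laurent s p) (laurent t q) z =
  trans (coeff-addP (s ℤ.⊓ t) _ _ z)
        (cong₂ ℕ._+_ (coeff-padTo p (ℤP.i⊓j≤i s t) z) (coeff-padTo q (ℤP.i⊓j≤j s t) z))

coeff-𝟘 : ∀ z → coeff 𝟘 z ≡ 0
coeff-𝟘 z with + 0 ℤ.≤? z
... | yes _ = refl
... | no _ = refl

coeff-mono-at : ∀ c w → coeff (mono c w) w ≡ c
coeff-mono-at c w = trans (cong (coeff (mono c w)) (sym (ℤP.+-identityʳ w))) (coeff-offset w (c ∷ []) 0)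

coeff-mono-off : ∀ c w {z} → z ≢ w → coeff (mono c w) z ≡ 0
coeff-mono-off c w {z} z≢w with below⊎offset w z
... | inj₁ z<w = coeff-below w _ z<w
... | inj₂ (zero , refl) = contradiction (ℤP.+-identityʳ w) z≢w
... | inj₂ (suc j , refl) = coeff-offset w (c ∷ []) (suc j)

coeff-mono≢0⇒≡ : ∀ c w {z} → coeff (mono c w) z ≢ 0 → z ≡ w
coeff-mono≢0⇒≡ c w {z} c≢0 with z ℤ.≟ w
... | yes z≡w = z≡w
... | no z≢w = contradiction (coeff-mono-off c w z≢w) c≢0

coeffSum : Laurent → ℕ
coeffSum f = sum (coeffs f)

sum-addP : ∀ p q → sum (addP p q) ≡ sum p ℕ.+ sum q
sum-addP []      q       = refl
sum-addP (a ∷ p) []      = sym (ℕP.+-identityʳ _)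
sum-addP (a ∷ p) (b ∷ q) = trans (cong (a ℕ.+ b ℕ.+_) (sum-addP p q)) (interchange a b (sum p) (sum q))
  where open +-*-Solver
        interchange : ∀ a b x y → a ℕ.+ b ℕ.+ (x ℕ.+ y) ≡ a ℕ.+ x ℕ.+ (b ℕ.+ y)
        interchange = solve 4 (λ a b x y → a :+ b :+ (x :+ y) := a :+ x :+ (b :+ y)) refl

sum-map-* : ∀ a q → sum (map (a ℕ.*_) q) ≡ a ℕ.* sum q
sum-map-* a []      = sym (ℕP.*-zeroʳ a)
sum-map-* a (b ∷ q) = trans (cong (a ℕ.* b ℕ.+_) (sum-map-* a q)) (sym (ℕP.*-distribˡ-+ a b (sum q)))

sum-mulP : ∀ p q → sum (mulP p q) ≡ sum p ℕ.* sum q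
sum-mulP []      q = refl
sum-mulP (a ∷ p) q = begin
  sum (addP (map (a ℕ.*_) q) (0 ∷ mulP p q))  ≡⟨ sum-addP (map (a ℕ.*_) q) (0 ∷ mulP p q) ⟩
  sum (map (a ℕ.*_) q) ℕ.+ sum (mulP p q)     ≡⟨ cong₂ ℕ._+_ (sum-map-* a q) (sum-mulP p q) ⟩
  a ℕ.* sum q ℕ.+ sum p ℕ.* sum q             ≡⟨ ℕP.*-distribʳ-+ (sum q) a (sum p) ⟨
  (a ℕ.+ sum p) ℕ.* sum q                     ∎
  where open ≡-Reasoning

sum-pad : ∀ a p → sum (replicate a 0 ++ p) ≡ sum p
sum-pad zero    p = refl
sum-pad (suc a) p = sum-pad a p

sum-cong-nth : ∀ p q → (∀ j → nth p j ≡ nth q j) → sum p ≡ sum q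
sum-cong-nth []      []      p≗q = refl
sum-cong-nth []      (b ∷ q) p≗q = cong₂ ℕ._+_ (p≗q 0) (sum-cong-nth [] q (λ j → p≗q (suc j)))
sum-cong-nth (a ∷ p) []      p≗q = cong₂ ℕ._+_ (p≗q 0) (sum-cong-nth p [] (λ j → p≗q (suc j)))
sum-cong-nth (a ∷ p) (b ∷ q) p≗q = cong₂ ℕ._+_ (p≗q 0) (sum-cong-nth p q (λ j → p≗q (suc j)))

coeffSum-⊗ : ∀ f g → coeffSum (f ⊗ g) ≡ coeffSum f ℕ.* coeffSum g
coeffSum-⊗ (laurent _ p) (laurent _ q) = sum-mulP p q

coeffSum-cong : ∀ f g → f ≈ g → coeffSum f ≡ coeffSum g
coeffSum-cong (laurent s p) (laurent t q) f≈g = begin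
  sum p         ≡⟨ sum-pad ℤ.∣ s ℤ.- m ∣ p ⟨
  sum padded-p  ≡⟨ sum-cong-nth padded-p padded-q padded-agree ⟩
  sum padded-q  ≡⟨ sum-pad ℤ.∣ t ℤ.- m ∣ q ⟩
  sum q         ∎
  where
    open ≡-Reasoning
    m = s ℤ.⊓ t
    padded-p = replicate ℤ.∣ s ℤ.- m ∣ 0 ++ p
    padded-q = replicate ℤ.∣ t ℤ.- m ∣ 0 ++ q
    padded-agree : ∀ j → nth padded-p j ≡ nth padded-q j
    padded-agree j = begin
      nth padded-p j                        ≡⟨ coeff-offset m padded-p j ⟨
      coeff (laurent m padded-p) (m ℤ.+ + j) ≡⟨ coeff-padTo p (ℤP.i⊓j≤i s t) _ ⟩
      coeff (laurent s p) (m ℤ.+ + j)        ≡⟨ f≈g _ ⟩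
      coeff (laurent t q) (m ℤ.+ + j)        ≡⟨ coeff-padTo q (ℤP.i⊓j≤j s t) _ ⟨
      coeff (laurent m padded-q) (m ℤ.+ + j) ≡⟨ coeff-offset m padded-q j ⟩
      nth padded-q j                        ∎

IsUnit⇒coeffSum≡1 : ∀ {u} → IsUnit u → coeffSum u ≡ 1
IsUnit⇒coeffSum≡1 {u} (v , uv≈𝟙) =
  ℕP.m*n≡1⇒m≡1 (coeffSum u) (coeffSum v) (trans (sym (coeffSum-⊗ u v)) (coeffSum-cong (u ⊗ v) 𝟙 uv≈𝟙))

sum≡0⇒nth≡0 : ∀ p → sum p ≡ 0 → ∀ j → nth p j ≡ 0
sum≡0⇒nth≡0 []      _   j       = refl
sum≡0⇒nth≡0 (a ∷ p) Σ≡0 zero    = ℕP.m+n≡0⇒m≡0 a Σ≡0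
sum≡0⇒nth≡0 (a ∷ p) Σ≡0 (suc j) = sum≡0⇒nth≡0 p (ℕP.m+n≡0⇒n≡0 a Σ≡0) j

sum≡1⇒unitVector : ∀ p → sum p ≡ 1 → ∃ λ i → ∀ j → nth p j ≡ nth (replicate i 0 ++ 1 ∷ []) j
sum≡1⇒unitVector (zero ∷ p) Σ≡1 with sum≡1⇒unitVector p Σ≡1
... | i , p≗eᵢ = suc i , λ { zero → refl ; (suc j) → p≗eᵢ j }
sum≡1⇒unitVector (suc zero ∷ p) Σ≡1 =
  0 , λ { zero → refl ; (suc j) → sum≡0⇒nth≡0 p (ℕP.suc-injective Σ≡1) j }
sum≡1⇒unitVector (suc (suc a) ∷ p) Σ≡1 with ℕP.suc-injective Σ≡1
... | ()

IsUnit⇒≈x^ : ∀ u → IsUnit u → ∃ λ w → u ≈ mono 1 w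
IsUnit⇒≈x^ u@(laurent s p) u-unit with sum≡1⇒unitVector p (IsUnit⇒coeffSum≡1 {u} u-unit)
... | i , p≗eᵢ = s ℤ.+ + i , λ z → trans (coeff-cong-nth s p≗eᵢ z) (coeff-pad i s (1 ∷ []) z)

mulP-identityʳ : ∀ p → mulP p (1 ∷ []) ≡ p
mulP-identityʳ []      = refl
mulP-identityʳ (a ∷ p) = cong₂ _∷_ (trans (ℕP.+-identityʳ _) (ℕP.*-identityʳ a)) (mulP-identityʳ p)

≈x^⇒IsUnit : ∀ g w → g ≈ mono 1 w → IsUnit g
≈x^⇒IsUnit g@(laurent s p) w g≈xʷ = mono 1 (- w) , λ z → begin
  coeff (laurent (s ℤ.+ - w) (mulP p (1 ∷ []))) z    ≡⟨ cong (λ r → coeff (laurent (s ℤ.+ - w) r) z) (mulP-identityʳ p) ⟩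
  coeff (laurent (s ℤ.+ - w) p) z                    ≡⟨ cong (coeff (laurent (s ℤ.+ - w) p)) (cancel z w) ⟨
  coeff (laurent (s ℤ.+ - w) p) (z ℤ.+ w ℤ.+ - w)    ≡⟨ coeff-shift s (- w) p (z ℤ.+ w) ⟩
  coeff g (z ℤ.+ w)                                  ≡⟨ g≈xʷ (z ℤ.+ w) ⟩
  coeff (mono 1 w) (z ℤ.+ w)                         ≡⟨ cong (λ t → coeff (mono 1 t) (z ℤ.+ w)) (ℤP.+-identityˡ w) ⟨
  coeff (laurent (+ 0 ℤ.+ w) (1 ∷ [])) (z ℤ.+ w)     ≡⟨ coeff-shift (+ 0) w (1 ∷ []) z ⟩
  coeff 𝟙 z                                          ∎
  where open ≡-Reasoning
        cancel : ∀ a b → a ℤ.+ b ℤ.+ - b ≡ a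
        cancel = solve-∀

SuppGt1⇒≉mono : ∀ f c w → SuppGt1 f → ¬ f ≈ mono c w
SuppGt1⇒≉mono f c w (a , b , a≢b , fa≢0 , fb≢0) f≈cxʷ =
  a≢b (trans (coeff-mono≢0⇒≡ c w (λ ca≡0 → fa≢0 (trans (f≈cxʷ a) ca≡0)))
      (sym (coeff-mono≢0⇒≡ c w (λ cb≡0 → fb≢0 (trans (f≈cxʷ b) cb≡0)))))

SuppGt1⇒¬IsUnit : ∀ f → SuppGt1 f → ¬ IsUnit f
SuppGt1⇒¬IsUnit f supp f-unit with IsUnit⇒≈x^ f f-unit
... | w , f≈xʷ = SuppGt1⇒≉mono f 1 w supp f≈xʷ

infix 4 _∣ᶜ_ _∣ˡ_

_∣ᶜ_ : ℕ → Laurent → Set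
d ∣ᶜ f = ∀ z → d ∣ coeff f z

_∣ˡ_ : ℕ → List ℕ → Set
d ∣ˡ p = ∀ j → d ∣ nth p j

∣ᶜ⇒∣ˡ : ∀ {d} s p → d ∣ᶜ laurent s p → d ∣ˡ p
∣ᶜ⇒∣ˡ {d} s p d∣f j = subst (d ∣_) (coeff-offset s p j) (d∣f (s ℤ.+ + j))

∣ˡ⇒∣ᶜ : ∀ {d} s p → d ∣ˡ p → d ∣ᶜ laurent s p
∣ˡ⇒∣ᶜ {d} s p d∣p z with s ℤ.≤? z
... | yes _ = d∣p _
... | no _ = d ∣0

∣ˡ-addP : ∀ {d} p q → d ∣ˡ p → d ∣ˡ q → d ∣ˡ addP p q
∣ˡ-addP {d} p q d∣p d∣q j = subst (d ∣_) (sym (nth-addP p q j)) (∣m∣n⇒∣m+n (d∣p j) (d∣q j))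

∣ˡ-mulPˡ : ∀ {d} p q → d ∣ˡ p → d ∣ˡ mulP p q
∣ˡ-mulPˡ {d} []      q d∣p j = d ∣0
∣ˡ-mulPˡ {d} (a ∷ p) q d∣p = ∣ˡ-addP (map (a ℕ.*_) q) (0 ∷ mulP p q) d∣aq d∣0∷pq
  where
    d∣aq : d ∣ˡ map (a ℕ.*_) q
    d∣aq j = subst (d ∣_) (sym (nth-map (a ℕ.*_) (ℕP.*-zeroʳ a) q j)) (∣m⇒∣m*n (nth q j) (d∣p 0))
    d∣0∷pq : d ∣ˡ 0 ∷ mulP p q
    d∣0∷pq zero    = d ∣0
    d∣0∷pq (suc j) = ∣ˡ-mulPˡ p q (λ i → d∣p (suc i)) j

∣ˡ-mulPʳ : ∀ {d} p q → d ∣ˡ q → d ∣ˡ mulP p q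
∣ˡ-mulPʳ {d} []      q d∣q j = d ∣0
∣ˡ-mulPʳ {d} (a ∷ p) q d∣q = ∣ˡ-addP (map (a ℕ.*_) q) (0 ∷ mulP p q) d∣aq d∣0∷pq
  where
    d∣aq : d ∣ˡ map (a ℕ.*_) q
    d∣aq j = subst (d ∣_) (sym (nth-map (a ℕ.*_) (ℕP.*-zeroʳ a) q j)) (∣n⇒∣m*n a (d∣q j))
    d∣0∷pq : d ∣ˡ 0 ∷ mulP p q
    d∣0∷pq zero    = d ∣0
    d∣0∷pq (suc j) = ∣ˡ-mulPʳ p q d∣q j

∣ᶜ-⊗ˡ : ∀ {d} g h → d ∣ᶜ g → d ∣ᶜ g ⊗ h
∣ᶜ-⊗ˡ (laurent s p) (laurent t q) d∣g =
  ∣ˡ⇒∣ᶜ (s ℤ.+ t) (mulP p q) (∣ˡ-mulPˡ p q (∣ᶜ⇒∣ˡ s p d∣g))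

∣ᶜ-⊗ʳ : ∀ {d} g h → d ∣ᶜ h → d ∣ᶜ g ⊗ h
∣ᶜ-⊗ʳ (laurent s p) (laurent t q) d∣h =
  ∣ˡ⇒∣ᶜ (s ℤ.+ t) (mulP p q) (∣ˡ-mulPʳ p q (∣ᶜ⇒∣ˡ t q d∣h))

∣ᶜ-resp-≈ : ∀ {d} f g → f ≈ g → d ∣ᶜ g → d ∣ᶜ f
∣ᶜ-resp-≈ {d} f g f≈g d∣g z = subst (d ∣_) (sym (f≈g z)) (d∣g z)

∣ᶜ-𝟘 : ∀ d → d ∣ᶜ 𝟘
∣ᶜ-𝟘 d z = subst (d ∣_) (sym (coeff-𝟘 z)) (d ∣0)

∣ᶜ-⊕ : ∀ {d} f g → d ∣ᶜ f → d ∣ᶜ g → d ∣ᶜ f ⊕ g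
∣ᶜ-⊕ {d} f g d∣f d∣g z = subst (d ∣_) (sym (coeff-⊕ f g z)) (∣m∣n⇒∣m+n (d∣f z) (d∣g z))

∣ᶜ-mono : ∀ {d c} w → d ∣ c → d ∣ᶜ mono c w
∣ᶜ-mono {d} {c} w d∣c z with z ℤ.≟ w
... | yes refl = subst (d ∣_) (sym (coeff-mono-at c w)) d∣c
... | no z≢w = subst (d ∣_) (sym (coeff-mono-off c w z≢w)) (d ∣0)

≈mono⇒∣ᶜ : ∀ g c w → g ≈ mono c w → c ∣ᶜ g
≈mono⇒∣ᶜ g c w g≈cxʷ = ∣ᶜ-resp-≈ g (mono c w) g≈cxʷ (∣ᶜ-mono w ∣-refl)

StrictlyDecreasing : ∀ {m} → (Fin m → ℤ) → Set
StrictlyDecreasing k = ∀ i j → i < j → k i > k j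

∣ᶜ-sumTerms : ∀ {d m} (c : Fin m → ℕ) k → (∀ i → d ∣ c i) → d ∣ᶜ sumTerms c k
∣ᶜ-sumTerms {d} {zero}  c k d∣c = ∣ᶜ-𝟘 d
∣ᶜ-sumTerms {d} {suc m} c k d∣c =
  ∣ᶜ-⊕ (mono (c Fin.zero) (k Fin.zero)) (sumTerms (c ∘ Fin.suc) (k ∘ Fin.suc))
       (∣ᶜ-mono (k Fin.zero) (d∣c Fin.zero)) (∣ᶜ-sumTerms (c ∘ Fin.suc) (k ∘ Fin.suc) (d∣c ∘ Fin.suc))

coeff-sumTerms-off : ∀ {m} (c : Fin m → ℕ) k {z} → (∀ i → k i ≢ z) → coeff (sumTerms c k) z ≡ 0
coeff-sumTerms-off {zero}  c k {z} _    = coeff-𝟘 z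
coeff-sumTerms-off {suc m} c k {z} k≢z = trans (coeff-⊕ (mono (c Fin.zero) (k Fin.zero)) _ z)
  (cong₂ ℕ._+_ (coeff-mono-off _ _ (k≢z Fin.zero ∘ sym))
               (coeff-sumTerms-off (c ∘ Fin.suc) (k ∘ Fin.suc) (k≢z ∘ Fin.suc)))

coeff-sumTerms : ∀ {m} (c : Fin m → ℕ) {k} → StrictlyDecreasing k → ∀ i → coeff (sumTerms c k) (k i) ≡ c i
coeff-sumTerms {suc m} c {k} k↓ i = trans (coeff-⊕ (mono (c Fin.zero) (k Fin.zero)) _ (k i)) (head-tail i)
  where
    tail↓ : StrictlyDecreasing (k ∘ Fin.suc)
    tail↓ a b a<b = k↓ (Fin.suc a) (Fin.suc b) (ℕ.s≤s a<b)
    k₀≢tail : ∀ j → k (Fin.suc j) ≢ k Fin.zero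
    k₀≢tail j eq = ℤP.<-irrefl eq (k↓ Fin.zero (Fin.suc j) (ℕ.s≤s ℕ.z≤n))
    head-tail : ∀ i → coeff (mono (c Fin.zero) (k Fin.zero)) (k i)
                        ℕ.+ coeff (sumTerms (c ∘ Fin.suc) (k ∘ Fin.suc)) (k i) ≡ c i
    head-tail Fin.zero = trans
      (cong₂ ℕ._+_ (coeff-mono-at (c Fin.zero) (k Fin.zero)) (coeff-sumTerms-off (c ∘ Fin.suc) (k ∘ Fin.suc) k₀≢tail))
      (ℕP.+-identityʳ _)
    head-tail (Fin.suc j) =
      cong₂ ℕ._+_ (coeff-mono-off _ _ (k₀≢tail j)) (coeff-sumTerms (c ∘ Fin.suc) tail↓ j)

gcdAll∣ : ∀ {m} (c : Fin m → ℕ) i → gcdAll c ∣ c i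
gcdAll∣ c Fin.zero    = gcd[m,n]∣m _ _
gcdAll∣ c (Fin.suc i) = ∣-trans (gcd[m,n]∣n (c Fin.zero) (gcdAll (c ∘ Fin.suc))) (gcdAll∣ (c ∘ Fin.suc) i)

∣gcdAll : ∀ {d m} (c : Fin m → ℕ) → (∀ i → d ∣ c i) → d ∣ gcdAll c
∣gcdAll {d} {zero}  c _   = d ∣0
∣gcdAll {d} {suc m} c d∣c = gcd-greatest (d∣c Fin.zero) (∣gcdAll (c ∘ Fin.suc) (d∣c ∘ Fin.suc))

Primitive : Laurent → Set
Primitive f = ∀ d → d ∣ᶜ f → d ≡ 1

Primitive-sumTerms⇔gcdAll≡1 : ∀ {m} (c : Fin m → ℕ) {k} → StrictlyDecreasing k →
                              Primitive (sumTerms c k) ⇔ gcdAll c ≡ 1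
Primitive-sumTerms⇔gcdAll≡1 c {k} k↓ = mk⇔
  (λ prim → prim (gcdAll c) (∣ᶜ-sumTerms c k (gcdAll∣ c)))
  (λ gcd≡1 d d∣f → ∣1⇒≡1 (subst (d ∣_) gcd≡1 (∣gcdAll c λ i →
     subst (d ∣_) (coeff-sumTerms c k↓ i) (d∣f (k i)))))

_÷_ : Laurent → (d : ℕ) → .{{NonZero d}} → Laurent
f ÷ d = laurent (shift f) (map (_/ d) (coeffs f))

coeff-÷ : ∀ f d .{{_ : NonZero d}} z → coeff (f ÷ d) z ≡ coeff f z / d
coeff-÷ (laurent s p) d = coeff-map (_/ d) (0/n≡0 d) s p

nth-addP-[0] : ∀ p j → nth (addP p (0 ∷ [])) j ≡ nth p j
nth-addP-[0] []      zero    = refl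
nth-addP-[0] []      (suc j) = refl
nth-addP-[0] (a ∷ p) zero    = ℕP.+-identityʳ a
nth-addP-[0] (a ∷ p) (suc j) = trans (nth-addP p [] j) (ℕP.+-identityʳ _)

coeff-scalar-⊗ : ∀ c f z → coeff (mono c (+ 0) ⊗ f) z ≡ c ℕ.* coeff f z
coeff-scalar-⊗ c (laurent s p) z = begin
  coeff (laurent (+ 0 ℤ.+ s) (mulP (c ∷ []) p)) z  ≡⟨ cong (λ t → coeff (laurent t _) z) (ℤP.+-identityˡ s) ⟩
  coeff (laurent s (mulP (c ∷ []) p)) z            ≡⟨ coeff-cong-nth s (nth-addP-[0] (map (c ℕ.*_) p)) z ⟩
  coeff (laurent s (map (c ℕ.*_) p)) z             ≡⟨ coeff-map (c ℕ.*_) (ℕP.*-zeroʳ c) s p z ⟩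
  c ℕ.* coeff (laurent s p) z                      ∎
  where open ≡-Reasoning

≈scalar-⊗-÷ : ∀ f d .{{_ : NonZero d}} → d ∣ᶜ f → f ≈ mono d (+ 0) ⊗ (f ÷ d)
≈scalar-⊗-÷ f d d∣f z = sym (begin
  coeff (mono d (+ 0) ⊗ (f ÷ d)) z  ≡⟨ coeff-scalar-⊗ d (f ÷ d) z ⟩
  d ℕ.* coeff (f ÷ d) z             ≡⟨ cong (d ℕ.*_) (coeff-÷ f d z) ⟩
  d ℕ.* (coeff f z / d)             ≡⟨ m*[n/m]≡n (d∣f z) ⟩
  coeff f z                         ∎)
  where open ≡-Reasoning

SuppGt1-÷ : ∀ f d .{{_ : NonZero d}} → d ∣ᶜ f → SuppGt1 f → SuppGt1 (f ÷ d)
SuppGt1-÷ f d d∣f (a , b , a≢b , fa≢0 , fb≢0) = a , b , a≢b , nonzero-after-÷ fa≢0 , nonzero-after-÷ fb≢0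
  where
    nonzero-after-÷ : ∀ {z} → coeff f z ≢ 0 → coeff (f ÷ d) z ≢ 0
    nonzero-after-÷ {z} fz≢0 f÷d≡0 = fz≢0 (begin
      coeff f z                         ≡⟨ ≈scalar-⊗-÷ f d d∣f z ⟩
      coeff (mono d (+ 0) ⊗ (f ÷ d)) z  ≡⟨ coeff-scalar-⊗ d (f ÷ d) z ⟩
      d ℕ.* coeff (f ÷ d) z             ≡⟨ cong (d ℕ.*_) f÷d≡0 ⟩
      d ℕ.* 0                           ≡⟨ ℕP.*-zeroʳ d ⟩
      0                                 ∎)
      where open ≡-Reasoning

IsUnit⇒IsMonomial : ∀ u → IsUnit u → IsMonomial u
IsUnit⇒IsMonomial u u-unit with IsUnit⇒≈x^ u u-unit
... | w , u≈xʷ = 1 , w , ℕP.≤-refl , u≈xʷ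

Irreducible⇒Monolithic : ∀ f → Irreducible f → Monolithic f
Irreducible⇒Monolithic f (f≉𝟘 , _ , factor) =
  f≉𝟘 , λ g h f≈gh → Sum.map (IsUnit⇒IsMonomial g) (IsUnit⇒IsMonomial h) (factor g h f≈gh)

Irreducible⇒Primitive : ∀ f → SuppGt1 f → Irreducible f → Primitive f
Irreducible⇒Primitive f _ (f≉𝟘 , _ , _) zero 0∣f =
  contradiction (λ z → trans (0∣⇒≡0 (0∣f z)) (sym (coeff-𝟘 z))) f≉𝟘
Irreducible⇒Primitive f _ _ (suc zero) _ = refl
Irreducible⇒Primitive f supp (_ , _ , factor) d@(suc (suc _)) d∣f =
  ⊥-elim (Sum.[ d-not-unit , SuppGt1⇒¬IsUnit (f ÷ d) (SuppGt1-÷ f d d∣f supp) ]′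
                (factor (mono d (+ 0)) (f ÷ d) (≈scalar-⊗-÷ f d d∣f)))
  where
    d-not-unit : ¬ IsUnit (mono d (+ 0))
    d-not-unit d-unit with IsUnit⇒coeffSum≡1 {mono d (+ 0)} d-unit
    ... | ()

Monolithic∧Primitive⇒Irreducible : ∀ f → SuppGt1 f → Monolithic f → Primitive f → Irreducible f
Monolithic∧Primitive⇒Irreducible f supp (f≉𝟘 , monolithic) prim =
  f≉𝟘 , SuppGt1⇒¬IsUnit f supp , λ g h f≈gh →
    Sum.map (monomial-factor g λ c∣g → ∣ᶜ-resp-≈ f (g ⊗ h) f≈gh (∣ᶜ-⊗ˡ g h c∣g))
            (monomial-factor h λ c∣h → ∣ᶜ-resp-≈ f (g ⊗ h) f≈gh (∣ᶜ-⊗ʳ g h c∣h))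
            (monolithic g h f≈gh)
  where
    monomial-factor : ∀ u → (∀ {c} → c ∣ᶜ u → c ∣ᶜ f) → IsMonomial u → IsUnit u
    monomial-factor u lift (c , w , _ , u≈cxʷ) =
      ≈x^⇒IsUnit u w (subst (λ c → u ≈ mono c w) (prim c (lift (≈mono⇒∣ᶜ u c w u≈cxʷ))) u≈cxʷ)

-- The positivity of the coefficients c i is not needed.
lemma2p4 : (n : ℕ) (c : Fin (suc n) → ℕ) (k : Fin (suc n) → ℤ) →
    (∀ i → 1 ≤ c i) →
    (∀ i j → i < j → k i > k j) →
    SuppGt1 (sumTerms c k) →
    Irreducible (sumTerms c k) ⇔ (Monolithic (sumTerms c k) × gcdAll c ≡ 1)
lemma2p4 _ c k _ k↓ supp = mk⇔
  (λ irr → Irreducible⇒Monolithic f irr , to (Irreducible⇒Primitive f supp irr))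
  (λ (monolithic , gcd≡1) → Monolithic∧Primitive⇒Irreducible f supp monolithic (from gcd≡1))
  where
    f = sumTerms c k
    open Equivalence (Primitive-sumTerms⇔gcdAll≡1 c k↓)
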